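{- Let $\langle W_\mu,\mu,\mathcal{F}^\mu\rangle$ be a gtf-frame and $M_2=\langle W_\tau,\tau,\mathcal{F}^\tau,V_\tau\rangle$ a gtf-model. Let $f:W_\mu\to W_\tau$ be continuous and open, and define $V_\mu(q)=f^{ -1}(V_\tau(q))$ for every $q\in PV$. Then (the graph of) $f$ is a generalized $0$-topo-bisimulation between $M_1=\langle W_\mu,\mu,\mathcal{F}^\mu,V_\mu\rangle$ and $M_2$.
   Context: A generalized topology on a nonempty set $W$ is a family $\mu\subseteq P(W)$ with $\emptyset\in\mu$ and closed under unions of arbitrary nonempty subfamilies; $\bigcup\mu$ is the union of its members. A gtf-frame is $\langle W,\mu,\mathcal{F}\rangle$ where $\mu$ is a generalized topology on $W$ and $\mathcal{F}:W\to P(P(\bigcup\mu))$ satisfies: if $w\in\bigcup\mu$ then $X\in\mathcal{F}_w$ iff ($X\in\mu$ and $w\in X$); if $w\notin\bigcup\mu$ then $\mathcal{F}_w\subseteq\mu$. A gtf-model adds a valuation $V:PV\to P(W)$, $PV$ a countable set of propositional variables. $f:W_\mu\to W_\tau$ is continuous if $f^{ -1}(G')\in\mu$ for every $G'\in\tau$, and open if $f(G)\in\tau$ for every $G\in\mu$. A generalized $0$-topo-bisimulation between gtf-models $\langle W_\mu,\mu,\mathcal{F}^\mu,V_\mu\rangle$ and $\langle W_\tau,\tau,\mathcal{F}^\tau,V_\tau\rangle$ is a nonempty relation $T\subseteq W_\mu\times W_\tau$ such that whenever $wTw'$: (1) for every $q\in PV$, $w\in V_\mu(q)$ iff $w'\in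 V_\tau(q)$; (2) if $w\in O\in\mu$, then there is $O'\in\tau$ such that for each $v'\in O'$ there is $v\in O$ with $vTv'$; (3) if $w'\in O'\in\tau$, then there is $O\in\mu$ such that for each $v\in O$ there is $v'\in O'$ with $vTv'$. -}

module Defs where

open import Level using (Level; _⊔_; suc)
open import Data.Nat using (ℕ)
open import Data.Product using (Σ; ∃; _×_; _,_)
open import Data.Empty.Polymorphic using (⊥)
open import Relation.Binary.PropositionalEquality using (_≡_)
open import Function.Bundles using (_⇔_)
open import Relation.Nullary using (¬_)

Subset : ∀ {a} (ℓ : Level) → Set a → Set (a ⊔ suc ℓ)
Subset ℓ W = W → Set ℓ

∅ : ∀ {a ℓ} {W : Set a} → Subset ℓ W
∅ _ = ⊥

⋃ᶠ : ∀ {a ℓ} {W : Set a} {I : Set ℓ} → (I → Subset ℓ W) → Subset ℓ W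
⋃ᶠ {I = I} G w = Σ I λ i → G i w

-- A generalized topology on W: contains ∅ and is closed under unions of
-- arbitrary NONEMPTY subfamilies (a family indexed by an inhabited type I).
record IsGT {a ℓ} (W : Set a) (μ : Subset ℓ W → Set ℓ) : Set (a ⊔ suc ℓ) where
  field
    ∅∈ : μ ∅
    ⋃∈ : (I : Set ℓ) → I → (G : I → Subset ℓ W) →
         (∀ i → μ (G i)) → μ (⋃ᶠ G)

⋃μ : ∀ {a ℓ} {W : Set a} → (Subset ℓ W → Set ℓ) → Subset (a ⊔ suc ℓ) W
⋃μ μ w = Σ _ λ G → μ G × G w

record IsGTF {a ℓ} (W : Set a) (μ : Subset ℓ W → Set ℓ)
             (𝓕 : W → Subset ℓ W → Set ℓ) : Set (a ⊔ suc ℓ) where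
  field
    isGT   : IsGT W μ
    𝓕⊆⋃μ  : ∀ w X → 𝓕 w X → ∀ v → X v → ⋃μ μ v
    𝓕-in   : ∀ w → ⋃μ μ w → ∀ X → 𝓕 w X ⇔ (μ X × X w)
    𝓕-out  : ∀ w → ¬ (⋃μ μ w) → ∀ X → 𝓕 w X → μ X

PV : Set
PV = ℕ

Continuous : ∀ {a b ℓ} {Wμ : Set a} {Wτ : Set b} →
             (Subset ℓ Wμ → Set ℓ) → (Subset ℓ Wτ → Set ℓ) → (Wμ → Wτ) → Set (b ⊔ suc ℓ)
Continuous μ τ f = ∀ G' → τ G' → μ (λ w → G' (f w))

image : ∀ {a b ℓ} {Wμ : Set a} {Wτ : Set b} → (Wμ → Wτ) → Subset ℓ Wμ → Subset (a ⊔ b ⊔ ℓ) Wτ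
image f G y = Σ _ λ x → G x × f x ≡ y

-- Open map: images of μ-open sets are τ-open.  Since f(G) lives in a
-- possibly higher universe, W_μ, W_τ and the opens are taken at one level ℓ.
Open : ∀ {ℓ} {Wμ Wτ : Set ℓ} →
       (Subset ℓ Wμ → Set ℓ) → (Subset ℓ Wτ → Set ℓ) → (Wμ → Wτ) → Set (suc ℓ)
Open μ τ f = ∀ G → μ G → τ (image f G)

-- Generalized 0-topo-bisimulation between gtf-models
-- ⟨Wμ, μ, 𝓕μ, Vμ⟩ and ⟨Wτ, τ, 𝓕τ, Vτ⟩ (the frame data 𝓕 play no role in
-- the clauses, but they are part of the models).
record Is0TopoBisim {ℓ} {Wμ Wτ : Set ℓ}
       (μ : Subset ℓ Wμ → Set ℓ) (Vμ : PV → Subset ℓ Wμ)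
       (τ : Subset ℓ Wτ → Set ℓ) (Vτ : PV → Subset ℓ Wτ)
       (T : Wμ → Wτ → Set ℓ) : Set (suc ℓ) where
  field
    nonempty : Σ Wμ λ w → Σ Wτ λ w' → T w w'
    atoms    : ∀ {w w'} → T w w' → ∀ q → Vμ q w ⇔ Vτ q w'
    forth    : ∀ {w w'} → T w w' → ∀ O → μ O → O w →
               Σ (Subset ℓ Wτ) λ O' → τ O' × (∀ v' → O' v' → Σ Wμ λ v → O v × T v v')
    back     : ∀ {w w'} → T w w' → ∀ O' → τ O' → O' w' →
               Σ (Subset ℓ Wμ) λ O → μ O × (∀ v → O v → Σ Wτ λ v' → O' v' × T v v')

graph : ∀ {ℓ} {A B : Set ℓ} → (A → B) → A → B → Set ℓ
graph f w w' = f w ≡ w'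

module Submission where

open import Defs
open import Level using (Level)
open import Data.Product using (Σ; _×_; _,_)
open import Relation.Binary.PropositionalEquality using (refl)
open import Function.Bundles using (_⇔_)
open import Function.Construct.Identity using (⇔-id)

module _ {ℓ : Level} {Wμ Wτ : Set ℓ} (f : Wμ → Wτ) where

  graph-nonempty : Wμ → Σ Wμ λ w → Σ Wτ λ w' → graph f w w'
  graph-nonempty w = w , f w , refl

  graph-preserves-preimage : (V : Subset ℓ Wτ) →
    ∀ {w w'} → graph f w w' → V (f w) ⇔ V w'
  graph-preserves-preimage V refl = ⇔-id (V (f _))

  graph-forth : (μ : Subset ℓ Wμ → Set ℓ) (τ : Subset ℓ Wτ → Set ℓ) → Open μ τ f →
    ∀ O → μ O →
    Σ (Subset ℓ Wτ) λ O' → τ O' × (∀ v' → O' v' → Σ Wμ λ v → O v × graph f v v')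
  graph-forth μ τ open-f O μO = image f O , open-f O μO , λ { _ (v , Ov , refl) → v , Ov , refl }

  graph-back : (μ : Subset ℓ Wμ → Set ℓ) (τ : Subset ℓ Wτ → Set ℓ) → Continuous μ τ f →
    ∀ O' → τ O' →
    Σ (Subset ℓ Wμ) λ O → μ O × (∀ v → O v → Σ Wτ λ v' → O' v' × graph f v v')
  graph-back μ τ cont-f O' τO' = (λ v → O' (f v)) , cont-f O' τO' , λ v O'fv → f v , O'fv , refl

mainTheorem7 : ∀ {ℓ : Level} (Wμ Wτ : Set ℓ) → Wμ → Wτ →
    (μ : Subset ℓ Wμ → Set ℓ) (𝓕μ : Wμ → Subset ℓ Wμ → Set ℓ) → IsGTF Wμ μ 𝓕μ →
    (τ : Subset ℓ Wτ → Set ℓ) (𝓕τ : Wτ → Subset ℓ Wτ → Set ℓ) → IsGTF Wτ τ 𝓕τ →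
    (Vτ : PV → Subset ℓ Wτ) →
    (f : Wμ → Wτ) → Continuous μ τ f → Open μ τ f →
    Is0TopoBisim μ (λ q w → Vτ q (f w)) τ Vτ (graph f)
-- Only the generalized topologies matter.
mainTheorem7 _ _ w _ μ _ _ τ _ _ Vτ f cont-f open-f = record
  { nonempty = graph-nonempty f w
  ; atoms    = λ wTw' q → graph-preserves-preimage f (Vτ q) wTw'
  ; forth    = λ _ O μO _ → graph-forth f μ τ open-f O μO
  ; back     = λ _ O' τO' _ → graph-back f μ τ cont-f O' τO'
  }
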